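{- Let $p$ be a prime with $p \equiv 1 \pmod 6$. If $n \geq 1$ is an integer whose base-$p$ representation contains only the digits $0$ and $1$, then $M_n \equiv 1 \pmod p$.
   Context: The Motzkin numbers are $M_n = \sum_{k \geq 0} \binom{n}{2k} C_k$, where $C_k = \frac{1}{k+1}\binom{2k}{k}$ are the Catalan numbers. -}

module Defs where

open import Data.Nat using (ℕ; zero; suc; _+_; _*_; _/_)
open import Data.Nat.Combinatorics using (_C_)
open import Data.List using (List; []; _∷_; map; upTo)
open import Data.Nat.ListAction using (sum)

-- Catalan number C_k = (1/(k+1)) * binom(2k, k)  (exact division)
catalan : ℕ → ℕ
catalan k = ((2 * k) C k) / suc k

-- Motzkin number M_n = Σ_{k ≥ 0} binom(n, 2k) C_k ; terms with 2k > n vanish,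
-- so summing k over 0 .. n suffices.
motzkin : ℕ → ℕ
motzkin n = sum (map (λ k → (n C (2 * k)) * catalan k) (upTo (suc n)))

fromDigits : ℕ → List ℕ → ℕ
fromDigits b []       = 0
fromDigits b (d ∷ ds) = d + b * fromDigits b ds

{-# OPTIONS --safe #-}
-- Since C(2k,k) = C(2k,k+1) + C_k, the term C(n,2k)·C_k is the difference of
-- C(n,2k)·C(2k,k) and C(n,2k)·C(2k,k+1), so it suffices that p divides both when k ≥ 1.
-- Write p = 2h+1 and strip base-p digits off n (a 0 or 1) and k (some e), using Lucas'
-- congruence one digit at a time. If 1 ≤ e ≤ h, the lowest digit 2e of 2k exceeds that
-- of n. If e ≥ h+1, doubling carries: 2k has lowest digit 2e-p < e, killing C(2k,k), and
-- either 2e-p ≥ 3 exceeds the digit of n or e = h+1 and the digit h+2 of k+1 exceeds 1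
-- (here p ≥ 5 is used). If e = 0, C(2k,k+1) dies (1 > 0) and C(n,2k)·C(2k,k) is congruent
-- to the same product for the numbers with their lowest digits removed, so induction applies.
-- Only p ≥ 5 matters; a prime p ≡ 1 (mod 6) is such.
module Submission where

open import Defs
open import Data.Empty using (⊥-elim)
open import Data.List using (List)
open import Data.List.Relation.Unary.All using (All; []; _∷_)
open import Data.List.Relation.Unary.All.Properties using (map⁺; applyUpTo⁺₂)
open import Data.Nat
open import Data.Nat.Combinatorics using (_C_; nCk+nC[k+1]≡[n+1]C[k+1])
open import Data.Nat.DivMod
  using (m*n/n≡m; %-distribˡ-+; %-distribˡ-*; %-remove-+ʳ; m≡m%n+[m/n]*n; m%n<n)
open import Data.Nat.Divisibility
  using (_∣_; _∣0; divides; ∣⇒≤; m%n≡0⇒n∣m; n∣m⇒m%n≡0; ∣m⇒∣m*n; ∣n⇒∣m*n; ∣m∣n⇒∣m+n; ∣m+n∣m⇒∣n)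
open import Data.Nat.ListAction using (sum)
open import Data.Nat.Primality using (Prime; euclidsLemma; prime⇒nonZero; prime⇒nonTrivial)
open import Data.Nat.Properties
open import Algebra.Properties.CommutativeSemigroup +-commutativeSemigroup using (interchange)
open import Data.Nat.Tactic.RingSolver using (solve-∀)
open import Data.Product using (∃; ∃-syntax; _×_; _,_)
open import Data.Sum using (_⊎_; inj₁; inj₂)
open import Relation.Binary.Bundles using (Setoid)
open import Relation.Binary.Structures using (IsEquivalence)
open import Relation.Binary.PropositionalEquality
open import Relation.Nullary using (yes; no; contradiction)

∣sum : ∀ {d ns} → All (d ∣_) ns → d ∣ sum ns
∣sum {d} []           = d ∣0
∣sum     (d∣n ∷ d∣ns) = ∣m∣n⇒∣m+n d∣n (∣sum d∣ns)

binomial : ℕ → ℕ → ℕ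
binomial n       zero    = 1
binomial zero    (suc k) = 0
binomial (suc n) (suc k) = binomial n k + binomial n (suc k)

binomial≡C : ∀ n k → binomial n k ≡ n C k
binomial≡C n       zero    = refl
binomial≡C zero    (suc k) = refl
binomial≡C (suc n) (suc k) =
  trans (cong₂ _+_ (binomial≡C n k) (binomial≡C n (suc k))) (nCk+nC[k+1]≡[n+1]C[k+1] n k)

n<k⇒binomial≡0 : ∀ {n k} → n < k → binomial n k ≡ 0
n<k⇒binomial≡0 {zero}  {suc k} _         = refl
n<k⇒binomial≡0 {suc n} {suc k} (s≤s n<k) =
  cong₂ _+_ (n<k⇒binomial≡0 n<k) (n<k⇒binomial≡0 (m<n⇒m<1+n n<k))

binomial[n,n]≡1 : ∀ n → binomial n n ≡ 1
binomial[n,n]≡1 zero    = refl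
binomial[n,n]≡1 (suc n) = cong₂ _+_ (binomial[n,n]≡1 n) (n<k⇒binomial≡0 (n<1+n n))

binomial[n,1]≡n : ∀ n → binomial n 1 ≡ n
binomial[n,1]≡n zero    = refl
binomial[n,1]≡n (suc n) = cong suc (binomial[n,1]≡n n)

binomial-absorption : ∀ n k → suc k * binomial (suc n) (suc k) ≡ suc n * binomial n k
binomial-absorption zero    zero    = refl
binomial-absorption zero    (suc k) = *-zeroʳ (2 + k)
binomial-absorption (suc n) zero    =
  trans (*-identityˡ _) (trans (binomial[n,1]≡n (2 + n)) (sym (*-identityʳ (2 + n))))
binomial-absorption (suc n) (suc k) = begin
  (2 + k) * (X + Y)                            ≡⟨ distribute k X Y ⟩
  X + (suc k * X + (2 + k) * Y)                ≡⟨ cong₂ (λ u v → X + (u + v))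
                                                    (binomial-absorption n k)
                                                    (binomial-absorption n (suc k)) ⟩
  X + (suc n * binomial n k + suc n * binomial n (suc k))
                                               ≡⟨ cong (X +_) (*-distribˡ-+ (suc n) (binomial n k) _) ⟨
  (2 + n) * X                                  ∎
  where
    open ≡-Reasoning
    X Y : ℕ
    X = binomial (suc n) (suc k)
    Y = binomial (suc n) (2 + k)
    distribute : ∀ k x y → (2 + k) * (x + y) ≡ x + (suc k * x + (2 + k) * y)
    distribute = solve-∀

private
  module Central (k : ℕ) where
    A B : ℕ
    A = binomial (2 * k) k
    B = binomial (2 * k) (suc k)

    [k+1]*B≡k*A : suc k * B ≡ k * A
    [k+1]*B≡k*A = +-cancelˡ-≡ (suc k * A) _ _ (begin
      suc k * A + suc k * B  ≡⟨ *-distribˡ-+ (suc k) A B ⟨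
      suc k * (A + B)        ≡⟨ binomial-absorption (2 * k) k ⟩
      suc (2 * k) * A        ≡⟨ split k A ⟩
      suc k * A + k * A      ∎)
      where
        open ≡-Reasoning
        split : ∀ k a → suc (2 * k) * a ≡ suc k * a + k * a
        split = solve-∀

    B≤A : B ≤ A
    B≤A = *-cancelˡ-≤ (suc k) (begin
      suc k * B  ≡⟨ [k+1]*B≡k*A ⟩
      k * A      ≤⟨ *-monoˡ-≤ A (n≤1+n k) ⟩
      suc k * A  ∎)
      where open ≤-Reasoning

    [k+1]*[A∸B]≡A : suc k * (A ∸ B) ≡ A
    [k+1]*[A∸B]≡A = begin
      suc k * (A ∸ B)        ≡⟨ *-distribˡ-∸ (suc k) A B ⟩
      suc k * A ∸ suc k * B  ≡⟨ cong (suc k * A ∸_) [k+1]*B≡k*A ⟩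
      A + k * A ∸ k * A      ≡⟨ m+n∸n≡m A (k * A) ⟩
      A                      ∎
      where open ≡-Reasoning

    catalan≡A∸B : catalan k ≡ A ∸ B
    catalan≡A∸B = begin
      catalan k                  ≡⟨ cong (_/ suc k) (binomial≡C (2 * k) k) ⟨
      A / suc k                  ≡⟨ cong (_/ suc k) [k+1]*[A∸B]≡A ⟨
      suc k * (A ∸ B) / suc k    ≡⟨ cong (_/ suc k) (*-comm (suc k) (A ∸ B)) ⟩
      (A ∸ B) * suc k / suc k    ≡⟨ m*n/n≡m (A ∸ B) (suc k) ⟩
      A ∸ B                      ∎
      where open ≡-Reasoning

binomial[2k,k]≡binomial[2k,k+1]+catalan : ∀ k →
  binomial (2 * k) k ≡ binomial (2 * k) (suc k) + catalan k
binomial[2k,k]≡binomial[2k,k+1]+catalan k = begin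
  A            ≡⟨ m+[n∸m]≡n B≤A ⟨
  B + (A ∸ B)  ≡⟨ cong (B +_) catalan≡A∸B ⟨
  B + catalan k ∎
  where
    open ≡-Reasoning
    open Central k

module Congruence (m : ℕ) .{{_ : NonZero m}} where

  infix 4 _≈_
  -- A record rather than a synonym for x % m ≡ y % m, so that x and y can be inferred.
  record _≈_ (x y : ℕ) : Set where
    constructor mod-≡
    field %-≡ : x % m ≡ y % m

  ≈-isEquivalence : IsEquivalence _≈_
  ≈-isEquivalence = record
    { refl  = mod-≡ refl
    ; sym   = λ (mod-≡ e) → mod-≡ (sym e)
    ; trans = λ (mod-≡ e) (mod-≡ f) → mod-≡ (trans e f)
    }

  ≈-setoid : Setoid _ _
  ≈-setoid = record { isEquivalence = ≈-isEquivalence }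

  open IsEquivalence ≈-isEquivalence public
    using () renaming (refl to ≈-refl; trans to ≈-trans; reflexive to ≈-reflexive)

  +-cong : ∀ {x x′ y y′} → x ≈ x′ → y ≈ y′ → x + y ≈ x′ + y′
  +-cong {x} {x′} {y} {y′} (mod-≡ e) (mod-≡ f) = mod-≡ (begin
    (x + y) % m                  ≡⟨ %-distribˡ-+ x y m ⟩
    (x % m + y % m) % m          ≡⟨ cong₂ (λ u v → (u + v) % m) e f ⟩
    (x′ % m + y′ % m) % m        ≡⟨ %-distribˡ-+ x′ y′ m ⟨
    (x′ + y′) % m                ∎)
    where open ≡-Reasoning

  *-cong : ∀ {x x′ y y′} → x ≈ x′ → y ≈ y′ → x * y ≈ x′ * y′
  *-cong {x} {x′} {y} {y′} (mod-≡ e) (mod-≡ f) = mod-≡ (begin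
    (x * y) % m                  ≡⟨ %-distribˡ-* x y m ⟩
    (x % m * (y % m)) % m        ≡⟨ cong₂ (λ u v → (u * v) % m) e f ⟩
    (x′ % m * (y′ % m)) % m      ≡⟨ %-distribˡ-* x′ y′ m ⟨
    (x′ * y′) % m                ∎)
    where open ≡-Reasoning

  ∣⇒≈0 : ∀ {x} → m ∣ x → x ≈ 0
  ∣⇒≈0 {x} m∣x = mod-≡ (trans (n∣m⇒m%n≡0 x m m∣x) (sym (n∣m⇒m%n≡0 0 m (m ∣0))))

  ≈-resp-∣ : ∀ {x y} → x ≈ y → m ∣ y → m ∣ x
  ≈-resp-∣ {x} {y} (mod-≡ e) m∣y = m%n≡0⇒n∣m x m (trans e (n∣m⇒m%n≡0 y m m∣y))

module Lucas (p′ : ℕ) (prime : Prime (suc p′)) where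

  p : ℕ
  p = suc p′

  open Congruence p public
  open import Relation.Binary.Reasoning.Setoid ≈-setoid

  p∣binomial[p,1+j] : ∀ {j} → suc j < p → p ∣ binomial p (suc j)
  p∣binomial[p,1+j] {j} 1+j<p
    with euclidsLemma (suc j) (binomial p (suc j)) prime
           (divides (binomial p′ j) (trans (binomial-absorption p′ j) (*-comm p _)))
  ... | inj₁ p∣1+j = ⊥-elim (<⇒≱ 1+j<p (∣⇒≤ p∣1+j))
  ... | inj₂ p∣binomial = p∣binomial

  -- Coefficientwise, (1 + X)^(n + p) ≡ (1 + X)^n · (1 + X^p) (mod p), split at degree p.
  frobenius-low : ∀ n {k} → k < p → binomial (n + p) k ≈ binomial n k
  frobenius-low n       {zero}  _   = ≈-refl
  frobenius-low zero    {suc j} k<p = ∣⇒≈0 (p∣binomial[p,1+j] k<p)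
  frobenius-low (suc n) {suc j} k<p =
    +-cong (frobenius-low n (<⇒≤ k<p)) (frobenius-low n k<p)

  frobenius-high : ∀ n k → binomial (n + p) (k + p) ≈ binomial n (k + p) + binomial n k
  frobenius-high zero    zero    = ≈-reflexive (binomial[n,n]≡1 p)
  frobenius-high zero    (suc k) = ≈-reflexive (n<k⇒binomial≡0 (m<n+m p (s≤s z≤n)))
  frobenius-high (suc n) zero    = begin
    binomial (n + p) p′ + binomial (n + p) p
      ≈⟨ +-cong (frobenius-low n ≤-refl) (frobenius-high n zero) ⟩
    binomial n p′ + (binomial n p + 1)
      ≡⟨ +-assoc (binomial n p′) _ 1 ⟨
    binomial n p′ + binomial n p + 1 ∎
  frobenius-high (suc n) (suc k) = begin
    binomial (n + p) (k + p) + binomial (n + p) (suc k + p)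
      ≈⟨ +-cong (frobenius-high n k) (frobenius-high n (suc k)) ⟩
    (binomial n (k + p) + binomial n k) + (binomial n (suc k + p) + binomial n (suc k))
      ≡⟨ interchange (binomial n (k + p)) _ _ _ ⟩
    (binomial n (k + p) + binomial n (suc k + p)) + (binomial n k + binomial n (suc k)) ∎

  lucas : ∀ {b d} → b < p → d < p → ∀ a c →
          binomial (b + p * a) (d + p * c) ≈ binomial a c * binomial b d
  lucas {b} {d} b<p d<p = go
    where
      no-digit : ∀ x → x + p * 0 ≡ x
      no-digit x = trans (cong (x +_) (*-zeroʳ p)) (+-identityʳ x)
      next-digit : ∀ x a → x + p * suc a ≡ (x + p * a) + p
      next-digit x a =
        trans (cong (x +_) (trans (*-suc p a) (+-comm p (p * a)))) (sym (+-assoc x (p * a) p))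

      go : ∀ a c → binomial (b + p * a) (d + p * c) ≈ binomial a c * binomial b d
      go zero zero = begin
        binomial (b + p * 0) (d + p * 0)  ≡⟨ cong₂ binomial (no-digit b) (no-digit d) ⟩
        binomial b d                      ≡⟨ +-identityʳ _ ⟨
        1 * binomial b d                  ∎
      go zero (suc c) = ≈-reflexive (n<k⇒binomial≡0
        (subst₂ _<_ (sym (no-digit b)) (sym (next-digit d c)) (<-≤-trans b<p (m≤n+m p _))))
      go (suc a) zero = begin
        binomial (b + p * suc a) (d + p * 0)  ≡⟨ cong₂ binomial (next-digit b a) (no-digit d) ⟩
        binomial (b + p * a + p) d            ≈⟨ frobenius-low (b + p * a) d<p ⟩
        binomial (b + p * a) d                ≡⟨ cong (binomial (b + p * a)) (no-digit d) ⟨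
        binomial (b + p * a) (d + p * 0)      ≈⟨ go a zero ⟩
        1 * binomial b d                      ∎
      go (suc a) (suc c) = begin
        binomial (b + p * suc a) (d + p * suc c)
          ≡⟨ cong₂ binomial (next-digit b a) (next-digit d c) ⟩
        binomial (b + p * a + p) (d + p * c + p)
          ≈⟨ frobenius-high (b + p * a) (d + p * c) ⟩
        binomial (b + p * a) (d + p * c + p) + binomial (b + p * a) (d + p * c)
          ≡⟨ cong (λ j → binomial (b + p * a) j + binomial (b + p * a) (d + p * c))
                  (next-digit d c) ⟨
        binomial (b + p * a) (d + p * suc c) + binomial (b + p * a) (d + p * c)
          ≈⟨ +-cong (go a (suc c)) (go a c) ⟩
        binomial a (suc c) * binomial b d + binomial a c * binomial b d
          ≡⟨ +-comm (binomial a (suc c) * binomial b d) _ ⟩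
        binomial a c * binomial b d + binomial a (suc c) * binomial b d
          ≡⟨ *-distribʳ-+ (binomial b d) (binomial a c) _ ⟨
        binomial (suc a) (suc c) * binomial b d ∎

  p∣binomial[smaller-digit] : ∀ {m j a b c d} → m ≡ b + p * a → j ≡ d + p * c → b < d → d < p →
                              p ∣ binomial m j
  p∣binomial[smaller-digit] {a = a} {b} {c} {d} refl refl b<d d<p = ≈-resp-∣ (begin
    binomial (b + p * a) (d + p * c)  ≈⟨ lucas (<-trans b<d d<p) d<p a c ⟩
    binomial a c * binomial b d       ≡⟨ cong (binomial a c *_) (n<k⇒binomial≡0 b<d) ⟩
    binomial a c * 0                  ≡⟨ *-zeroʳ (binomial a c) ⟩
    0                                 ∎) (p ∣0)

  binomial[zero-digit]≈ : ∀ {m j a b c} → m ≡ b + p * a → j ≡ p * c → b < p →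
                          binomial m j ≈ binomial a c
  binomial[zero-digit]≈ {a = a} {c = c} refl refl b<p =
    ≈-trans (lucas b<p (s≤s z≤n) a c) (≈-reflexive (*-identityʳ (binomial a c)))

central : ℕ → ℕ → ℕ
central n k = binomial n (2 * k) * binomial (2 * k) k

offCentral : ℕ → ℕ → ℕ
offCentral n k = binomial n (2 * k) * binomial (2 * k) (suc k)

Bit : ℕ → Set
Bit d = d ≡ 0 ⊎ d ≡ 1

Bit⇒<2 : ∀ {b} → Bit b → b < 2
Bit⇒<2 (inj₁ refl) = s≤s z≤n
Bit⇒<2 (inj₂ refl) = s≤s (s≤s z≤n)

2*n≡n+n : ∀ n → 2 * n ≡ n + n
2*n≡n+n n = cong (n +_) (+-identityʳ n)

private
  double-zero : ∀ h f → 2 * (suc (2 * h) * f) ≡ suc (2 * h) * (2 * f)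
  double-zero = solve-∀
  double-noCarry : ∀ h e f → 2 * (e + suc (2 * h) * f) ≡ 2 * e + suc (2 * h) * (2 * f)
  double-noCarry = solve-∀
  double-carry : ∀ h r f → 2 * (suc h + r + suc (2 * h) * f) ≡ suc (2 * r) + suc (2 * h) * suc (2 * f)
  double-carry = solve-∀
  suc-carry : ∀ h f → suc (suc h + 0 + suc (2 * h) * f) ≡ 2 + h + suc (2 * h) * f
  suc-carry = solve-∀

module BinaryDigits (h : ℕ) (2≤h : 2 ≤ h) (prime : Prime (suc (2 * h))) where

  open Lucas (2 * h) prime

  -- Doubling k carries out of the lowest digit exactly in the carry case; 2k then has
  -- lowest digit 2r+1.
  data LowestDigit : ℕ → Set where
    zero    : ∀ f → LowestDigit (p * f)
    noCarry : ∀ e f → 1 ≤ e → e ≤ h → LowestDigit (e + p * f)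
    carry   : ∀ r f → r < h → LowestDigit (suc h + r + p * f)

  lowestDigit : ∀ k → LowestDigit k
  lowestDigit k = subst LowestDigit (sym k≡digit+p*rest) (classify (k % p) (k / p) (m%n<n k p))
    where
      k≡digit+p*rest : k ≡ k % p + p * (k / p)
      k≡digit+p*rest = trans (m≡m%n+[m/n]*n k p) (cong (k % p +_) (*-comm (k / p) p))

      classify : ∀ e f → e < p → LowestDigit (e + p * f)
      classify zero    f _ = zero f
      classify (suc e) f e<p with suc e ≤? h
      ... | yes e≤h = noCarry (suc e) f (s≤s z≤n) e≤h
      ... | no  e≰h with m≤n⇒∃[o]m+o≡n (≰⇒> e≰h)
      ... | r , refl = carry r f (+-cancelˡ-< h r h
                         (subst (h + r <_) (cong (h +_) (+-identityʳ h)) (≤-pred e<p)))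

  2≤p : 2 ≤ p
  2≤p = s≤s (≤-trans (s≤s z≤n) (≤-trans 2≤h (m≤m+n h (1 * h))))

  2*e<p : ∀ {e} → e ≤ h → 2 * e < p
  2*e<p e≤h = s≤s (*-monoʳ-≤ 2 e≤h)

  p∣binomial[b+p*a,2k] : ∀ {b e} → b < 2 → 1 ≤ e → e ≤ h → ∀ a f →
                          p ∣ binomial (b + p * a) (2 * (e + p * f))
  p∣binomial[b+p*a,2k] {b} {e} b<2 1≤e e≤h a f =
    p∣binomial[smaller-digit] refl (double-noCarry h e f)
      (<-≤-trans b<2 (*-monoʳ-≤ 2 1≤e)) (2*e<p e≤h)

  p∣central-step : ∀ {a b} → b < 2 → (∀ {f} → 1 ≤ f → p ∣ central a f) →
                   ∀ {k} → 1 ≤ k → p ∣ central (b + p * a) k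
  p∣central-step {a} {b} b<2 ih {k} 1≤k with lowestDigit k
  ... | zero f =
    ≈-resp-∣ (*-cong (binomial[zero-digit]≈ refl (double-zero h f) (<-≤-trans b<2 2≤p))
                     (binomial[zero-digit]≈ {c = f} (double-zero h f) refl (s≤s z≤n)))
             (ih (1≤p*f⇒1≤f 1≤k))
    where
      1≤p*f⇒1≤f : ∀ {f} → 1 ≤ p * f → 1 ≤ f
      1≤p*f⇒1≤f {zero}  1≤p*0 = contradiction (subst (1 ≤_) (*-zeroʳ p) 1≤p*0) λ ()
      1≤p*f⇒1≤f {suc f} _     = s≤s z≤n
  ... | noCarry e f 1≤e e≤h =
    ∣m⇒∣m*n (binomial (2 * (e + p * f)) (e + p * f)) (p∣binomial[b+p*a,2k] b<2 1≤e e≤h a f)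
  ... | carry r f r<h =
    ∣n⇒∣m*n (binomial (b + p * a) (2 * k′))
      (p∣binomial[smaller-digit] (double-carry h r f) refl 2r+1<h+1+r h+1+r<p)
    where
      k′ : ℕ
      k′ = suc h + r + p * f
      2r+1<h+1+r : suc (2 * r) < suc h + r
      2r+1<h+1+r = s≤s (subst (_< h + r) (sym (2*n≡n+n r)) (+-monoˡ-< r r<h))
      h+1+r<p : suc h + r < p
      h+1+r<p = s≤s (subst (h + r <_) (sym (2*n≡n+n h)) (+-monoʳ-< h r<h))

  p∣offCentral-step : ∀ {a b} → b < 2 → ∀ k → p ∣ offCentral (b + p * a) k
  p∣offCentral-step {a} {b} b<2 k with lowestDigit k
  ... | zero f =
    ∣n⇒∣m*n (binomial (b + p * a) (2 * (p * f)))
      (p∣binomial[smaller-digit] (double-zero h f) refl (s≤s z≤n) 2≤p)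
  ... | noCarry e f 1≤e e≤h =
    ∣m⇒∣m*n (binomial (2 * (e + p * f)) (suc (e + p * f))) (p∣binomial[b+p*a,2k] b<2 1≤e e≤h a f)
  ... | carry zero f r<h =
    ∣n⇒∣m*n (binomial (b + p * a) (2 * k′))
      (p∣binomial[smaller-digit] (double-carry h 0 f) (suc-carry h f) (s≤s (s≤s z≤n)) h+2<p)
    where
      k′ : ℕ
      k′ = suc h + 0 + p * f
      h+2<p : 2 + h < p
      h+2<p = s≤s (subst (2 + h ≤_) (sym (2*n≡n+n h)) (+-monoˡ-≤ h 2≤h))
  ... | carry r@(suc _) f r<h =
    ∣m⇒∣m*n (binomial (2 * k′) (suc k′))
      (p∣binomial[smaller-digit] refl (double-carry h r f)
        (<-≤-trans b<2 (s≤s (s≤s z≤n))) (s≤s (*-monoʳ-< 2 r<h)))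
    where
      k′ : ℕ
      k′ = suc h + r + p * f

  p∣central : ∀ {ds} → All Bit ds → ∀ {k} → 1 ≤ k → p ∣ central (fromDigits p ds) k
  p∣central []           {suc k} _ = p ∣0
  p∣central (bit ∷ bits)           = p∣central-step (Bit⇒<2 bit) (p∣central bits)

  p∣offCentral : ∀ {ds} → All Bit ds → ∀ k → p ∣ offCentral (fromDigits p ds) k
  p∣offCentral []           zero    = p ∣0
  p∣offCentral []           (suc k) = p ∣0
  p∣offCentral (bit ∷ bits)         = p∣offCentral-step (Bit⇒<2 bit)

  p∣binomial[n,2k]*catalan : ∀ {ds} → All Bit ds → ∀ {k} → 1 ≤ k →
                             p ∣ binomial (fromDigits p ds) (2 * k) * catalan k
  p∣binomial[n,2k]*catalan {ds} bits {k} 1≤k =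
    ∣m+n∣m⇒∣n (subst (p ∣_) central≡offCentral+term (p∣central bits 1≤k)) (p∣offCentral bits k)
    where
      X : ℕ
      X = binomial (fromDigits p ds) (2 * k)
      central≡offCentral+term :
        central (fromDigits p ds) k ≡ offCentral (fromDigits p ds) k + X * catalan k
      central≡offCentral+term =
        trans (cong (X *_) (binomial[2k,k]≡binomial[2k,k+1]+catalan k)) (*-distribˡ-+ X _ (catalan k))

  motzkin%p≡1 : ∀ {ds} → All Bit ds → motzkin (fromDigits p ds) % p ≡ 1 % p
  motzkin%p≡1 {ds} bits = %-remove-+ʳ 1 (∣sum (map⁺ (applyUpTo⁺₂ suc n p∣term)))
    where
      n : ℕ
      n = fromDigits p ds
      p∣term : ∀ i → p ∣ (n C (2 * suc i)) * catalan (suc i)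
      p∣term i = subst (λ x → p ∣ x * catalan (suc i)) (binomial≡C n (2 * suc i))
                       (p∣binomial[n,2k]*catalan bits (s≤s z≤n))

p%6≡1⇒p≡1+2h : ∀ p → p % 6 ≡ 1 → 1 < p → ∃[ h ] 2 ≤ h × p ≡ suc (2 * h)
p%6≡1⇒p≡1+2h p p%6≡1 1<p with p / 6 | m≡m%n+[m/n]*n p 6
... | zero  | p≡p%6+0 = contradiction (trans p≡p%6+0 (cong (_+ 0) p%6≡1)) (>⇒≢ 1<p)
... | suc t | p≡p%6+6q = 3 + 3 * t , s≤s (s≤s z≤n) ,
                          trans p≡p%6+6q (trans (cong (_+ suc t * 6) p%6≡1) (arith t))
  where
    arith : ∀ t → 1 + suc t * 6 ≡ suc (2 * (3 + 3 * t))
    arith = solve-∀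

mainTheorem6 : (p : ℕ) → (pp : Prime p) → p % 6 ≡ 1 →
    (n : ℕ) → n ≥ 1 →
    (∃ λ (ds : List ℕ) → All (λ d → d ≡ 0 ⊎ d ≡ 1) ds × fromDigits p ds ≡ n) →
    _%_ (motzkin n) p ⦃ prime⇒nonZero pp ⦄ ≡ _%_ 1 p ⦃ prime⇒nonZero pp ⦄
mainTheorem6 p pp p%6≡1 n _ (ds , bits , refl)
  with p%6≡1⇒p≡1+2h p p%6≡1 (nonTrivial⇒n>1 p ⦃ prime⇒nonTrivial pp ⦄)
... | h , 2≤h , refl = BinaryDigits.motzkin%p≡1 h 2≤h pp bits
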